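{- Let $\mathbf A=\langle A,R,',1\rangle$ be an orthogonal relational system with $R$ reflexive, and put $0=1'$. If $x,y\in A$, $x\perp y$ and $x\neq 0\neq y$, then $(x,y)\notin R$ and $(y,x)\notin R$.
   Context: A relational system with 1 and involution is $\langle A,R,',1\rangle$ where $A\neq\emptyset$, $R\subseteq A^2$, $':A\to A$ satisfies $a''=a$ and $(a,b)\in R\Rightarrow(b',a')\in R$, and $(x,1)\in R$ for all $x\in A$. $U_R(a,b)=\{c:(a,c)\in R,(b,c)\in R\}$. Elements $a,b$ are orthogonal ($a\perp b$) if $(a,b')\in R$. An element $w\in U_R(a,b)$ is a supremal element for $a,b$ if $(w,z)\in R$ for all $z\in U_R(a,b)$ with $z\neq w$. The system is orthogonal if (a) $U_R(x,x')=\{1\}$ for every $x$, and (b) whenever $x\perp y$ and $x\neq 0\neq y$, a supremal element for $x,y$ exists. -}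

module Defs where

open import Level using (Level; suc; _⊔_)
open import Data.Product using (_×_; Σ-syntax)
open import Relation.Binary.PropositionalEquality using (_≡_)
open import Relation.Nullary using (¬_)

-- A relational system with 1 and involution  ⟨A, R, ', 1⟩.
-- A ≠ ∅ is witnessed by the element 1.
record RelSys (a r : Level) : Set (suc (a ⊔ r)) where
  field
    Carrier : Set a
    R       : Carrier → Carrier → Set r
    _′      : Carrier → Carrier
    one     : Carrier
    invol   : ∀ x → (x ′) ′ ≡ x
    antitone : ∀ {x y} → R x y → R (y ′) (x ′)
    top     : ∀ x → R x one

  zero : Carrier
  zero = one ′

  U : Carrier → Carrier → Carrier → Set r
  U x y c = R x c × R y c

  _⊥_ : Carrier → Carrier → Set r
  x ⊥ y = R x (y ′)

  Supremal : Carrier → Carrier → Carrier → Set (a ⊔ r)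
  Supremal x y w = U x y w × (∀ z → U x y z → ¬ z ≡ w → R w z)

  Reflexive : Set (a ⊔ r)
  Reflexive = ∀ x → R x x

  -- orthogonal relational system:
  -- (a) U_R(x,x') = {1} for every x
  -- (b) x ⊥ y, x ≠ 0 ≠ y  ⇒  a supremal element for x, y exists
  Orthogonal : Set (a ⊔ r)
  Orthogonal =
    (∀ x c → U x (x ′) c → c ≡ one) × (∀ x → U x (x ′) one)
    × (∀ x y → x ⊥ y → ¬ x ≡ zero → ¬ y ≡ zero → Σ[ w ∈ Carrier ] Supremal x y w)

module Submission where

open import Defs
open import Level using (Level)
open import Relation.Binary.PropositionalEquality using (_≡_; sym; trans; cong; subst)
open import Relation.Nullary using (¬_)
open import Data.Product using (_×_; _,_)

module _ {a r : Level} (S : RelSys a r) where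
  open RelSys S

  ⊥-sym : ∀ {x y} → x ⊥ y → y ⊥ x
  ⊥-sym {x} {y} x⊥y = subst (λ t → R t (x ′)) (invol y) (antitone x⊥y)

  ′≡one⇒≡zero : ∀ {x} → x ′ ≡ one → x ≡ zero
  ′≡one⇒≡zero {x} x′≡1 = trans (sym (invol x)) (cong _′ x′≡1)

  -- If x ≤ y and x ⊥ y then x′ lies above both y and y′, so it is 1.
  ⊥-below⇒zero : (∀ x c → U x (x ′) c → c ≡ one) →
                 ∀ {x y} → x ⊥ y → R x y → x ≡ zero
  ⊥-below⇒zero upper-one {x} {y} x⊥y xRy =
    ′≡one⇒≡zero (upper-one y (x ′) (⊥-sym x⊥y , antitone xRy))

lemma2p12 : ∀ {a r : Level} (S : RelSys a r) → let open RelSys S in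
    Reflexive → Orthogonal →
    ∀ x y → x ⊥ y → ¬ x ≡ zero → ¬ y ≡ zero → ¬ R x y × ¬ R y x
lemma2p12 S _ (upper-one , _ , _) x y x⊥y x≢0 y≢0 =
    (λ xRy → x≢0 (⊥-below⇒zero S upper-one x⊥y xRy))
  , (λ yRx → y≢0 (⊥-below⇒zero S upper-one (⊥-sym S x⊥y) yRx))
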